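{- Let $2 \leq k < n \leq n' < \omega$. Then $T_{n', k}$ admits $\Delta_{n, k}$.
   Context: For $2\le k<n<\omega$, $T_{n,k}$ is the theory of the random $k$-ary $n$-clique-free hypergraph, i.e. of the Fraïssé limit of the class of finite $k$-uniform hypergraphs (with edge relation $R$, symmetric and irreflexive $k$-ary) containing no set of $n$ vertices all of whose $k$-subsets are edges. A pattern on $I$ is a subset-closed $\Delta\subseteq[I]^{<\aleph_0}$. For $S\subseteq[I]^k$ and $n>k$, $\Delta_{n,k}(S)$ is the pattern on $[I]^{k-1}$ consisting of all finite $s\subseteq[I]^{k-1}$ such that there is no $v\in[I]^{n-1}$ with $[v]^{k-1}\subseteq s$ and $[v]^k\subseteq S$. $\Delta_{n,k}:=\Delta_{n,k}(S_k)$, where $S_k\subseteq[\omega]^k$ is a random $k$-ary hypergraph on $\omega$ (up to equivalence of patterns this is independent of the choice). A formula $\varphi(\bar x,\bar y)$ of $T$ admits a pattern $\Delta$ on $J$ if there are $(\bar a_j:j\in J)$ in the monster model with: for every finite $s\subseteq J$, $\exists\bar x\bigwedge_{j\in s}\varphi(\bar x,\bar a_j)$ holds iff $s\in\Delta$; $T$ admits $\Delta$ if some formula of $T$ does. -}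

module Defs where

open import Data.Nat using (ℕ; zero; suc; pred) renaming (_<_ to _<ℕ_)
open import Data.Fin using (Fin; toℕ) renaming (zero to fz; suc to fs; _<_ to _<F_)
open import Data.Maybe using (Maybe; just; nothing; maybe′)
open import Data.Sum using (_⊎_; [_,_]′)
open import Data.Product using (Σ; _×_; _,_; proj₁)
open import Data.Empty using (⊥)
open import Data.Unit using (⊤)
open import Data.Bool using (Bool; true)
open import Data.List using (List)
open import Data.List.Relation.Unary.All using (All)
open import Data.List.Relation.Unary.Any using (Any)
open import Function.Bundles using (_⇔_)
open import Relation.Nullary using (¬_)
open import Relation.Binary.PropositionalEquality using (_≡_)

-- Finite combinatorics: a strictly increasing map Fin a → Fin b encodes
-- an a-element subset of an b-element (indexed) set; likewise Fin a → ℕ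
-- encodes an element of [ω]^a.

IncF : ∀ {a b} → (Fin a → Fin b) → Set
IncF f = ∀ i j → i <F j → f i <F f j

IncN : ∀ {a} → (Fin a → ℕ) → Set
IncN f = ∀ i j → i <F j → f i <ℕ f j

Injective : ∀ {a} {C : Set} → (Fin a → C) → Set
Injective f = ∀ i j → f i ≡ f j → i ≡ j

ext : ∀ {k} {C : Set} → C → (Fin (pred k) → C) → Fin k → C
ext {zero}  b a ()
ext {suc k} b a fz     = b
ext {suc k} b a (fs i) = a i

IsUniformHypergraph : ∀ k (C : Set) → ((Fin k → C) → Set) → Set
IsUniformHypergraph k C R =
  (∀ a → R a → Injective a) ×
  (∀ a b → R a → (∀ i → Σ (Fin k) λ j → a i ≡ b j)
                → (∀ j → Σ (Fin k) λ i → a i ≡ b j) → R b)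

IsClique : ∀ k {C : Set} → ((Fin k → C) → Set) → ∀ m → (Fin m → C) → Set
IsClique k R m w = Injective w × (∀ (f : Fin k → Fin m) → IncF f → R (λ i → w (f i)))

CliqueFree : ∀ k {C : Set} → ((Fin k → C) → Set) → ℕ → Set
CliqueFree k R n = ∀ (w : Fin n → _) → ¬ IsClique k R n w

-- Extension property relative to a side condition `Allowed`:
-- for every finite set A = {a_0,...,a_{m-1}} of distinct vertices and every
-- set P of (k-1)-subsets of A (given as a Bool-valued function on
-- increasing index tuples) satisfying `Allowed`, there is a new vertex b ∉ A such that for
-- every (k-1)-subset t of A:  R({b} ∪ t) iff t ∈ P.
ExtensionProperty : ∀ k (C : Set) → ((Fin k → C) → Set)
  → (∀ m → (Fin m → C) → ((Fin (pred k) → Fin m) → Bool) → Set) → Set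
ExtensionProperty k C R Allowed =
  ∀ m (a : Fin m → C) → Injective a → (P : (Fin (pred k) → Fin m) → Bool) →
  Allowed m a P →
  Σ C λ b → (∀ i → ¬ b ≡ a i) ×
    (∀ (t : Fin (pred k) → Fin m) → IncF t → (R (ext b (λ i → a (t i))) ⇔ (P t ≡ true)))

-- Adding a vertex joined exactly to the (k-1)-sets in P creates no n-clique:
-- there is no (n-1)-subset w of A all of whose (k-1)-subsets lie in P and
-- all of whose k-subsets are edges.
NoNewClique : ∀ k {C : Set} → ((Fin k → C) → Set) → ℕ
  → ∀ m → (Fin m → C) → ((Fin (pred k) → Fin m) → Bool) → Set
NoNewClique k R n m a P =
  ∀ (w : Fin (pred n) → Fin m) → IncF w →
  (∀ (g : Fin (pred k) → Fin (pred n)) → IncF g → P (λ i → w (g i)) ≡ true) →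
  ¬ (∀ (f : Fin k → Fin (pred n)) → IncF f → R (λ i → a (w (f i))))

-- Models of T_{n,k}: the axioms of the generic (Fraïssé limit) k-uniform
-- K_n-free hypergraph.
IsModelT : ∀ (n k : ℕ) (C : Set) → ((Fin k → C) → Set) → Set
IsModelT n k C R =
  IsUniformHypergraph k C R × CliqueFree k R n ×
  ExtensionProperty k C R (NoNewClique k R n)

IsRandomHypergraphOnℕ : ∀ k → ((Fin k → ℕ) → Set) → Set
IsRandomHypergraphOnℕ k S =
  IsUniformHypergraph k ℕ S × ExtensionProperty k ℕ S (λ _ _ _ → ⊤)

-- First-order formulas in the language {R} (R k-ary), with free
-- variables in V (well-scoped: quantifiers bind a fresh variable).

data Formula (k : ℕ) (V : Set) : Set where
  rel    : (Fin k → V) → Formula k V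
  equal  : V → V → Formula k V
  falsum : Formula k V
  neg    : Formula k V → Formula k V
  and    : Formula k V → Formula k V → Formula k V
  or     : Formula k V → Formula k V → Formula k V
  imp    : Formula k V → Formula k V → Formula k V
  all    : Formula k (Maybe V) → Formula k V
  ex     : Formula k (Maybe V) → Formula k V

Sat : ∀ {k} (C : Set) (R : (Fin k → C) → Set) {V : Set} → Formula k V → (V → C) → Set
Sat C R (rel t)     ρ = R (λ i → ρ (t i))
Sat C R (equal x y) ρ = ρ x ≡ ρ y
Sat C R falsum      ρ = ⊥
Sat C R (neg φ)     ρ = ¬ Sat C R φ ρ
Sat C R (and φ ψ)   ρ = Sat C R φ ρ × Sat C R ψ ρ
Sat C R (or φ ψ)    ρ = Sat C R φ ρ ⊎ Sat C R ψ ρ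
Sat C R (imp φ ψ)   ρ = Sat C R φ ρ → Sat C R ψ ρ
Sat C R (all φ)     ρ = ∀ (c : C) → Sat C R φ (maybe′ ρ c)
Sat C R (ex φ)      ρ = Σ C λ c → Sat C R φ (maybe′ ρ c)

-- Patterns.  A pattern on J is given as a predicate on finite subsets of J,
-- the finite subsets being represented by lists.

AdmitsT : ∀ (n k : ℕ) (J : Set) → (List J → Set) → Set₁
AdmitsT n k J Δ =
  Σ ℕ λ p → Σ ℕ λ q → Σ (Formula k (Fin p ⊎ Fin q)) λ φ →
  Σ Set λ C → Σ ((Fin k → C) → Set) λ R → IsModelT n k C R ×
  Σ (J → Fin q → C) λ a →
    ∀ (s : List J) →
      (Σ (Fin p → C) (λ x → All (λ j → Sat C R φ [ x , a j ]′) s)) ⇔ Δ s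

Subsets : ℕ → Set
Subsets m = Σ (Fin m → ℕ) IncN

-- u ∈ s (extensional comparison of the underlying tuples)
_∈S_ : ∀ {m} → (Fin m → ℕ) → List (Subsets m) → Set
u ∈S s = Any (λ j → ∀ i → proj₁ j i ≡ u i) s

Δ[_,_] : ∀ (n k : ℕ) → ((Fin k → ℕ) → Set) → List (Subsets (pred k)) → Set
Δ[ n , k ] S s =
  ¬ Σ (Fin (pred n) → ℕ) λ v → IncN v ×
      (∀ (g : Fin (pred k) → Fin (pred n)) → IncF g → (λ i → v (g i)) ∈S s) ×
      (∀ (f : Fin k → Fin (pred n)) → IncF f → S (λ i → v (f i)))

{-# OPTIONS --safe #-}
-- A model of T_{n',k} is built as the free completion of a K_{n'}-free base hypergraph: a vertex is
-- either a base point or a term `new A P` adjoined over finitely many earlier vertices A and adjacent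
-- exactly to the (k-1)-subsets of A selected by P, where adjoining is allowed only if it creates no
-- n'-clique.  An n'-clique cannot arise: all edges through its deepest vertex `new A P` are edges of
-- that vertex, so the rest of the clique would be a forbidden clique inside A.
--
-- The base points are n'-1 layers of copies of ℕ, the first n-1 of them low.  A k-set of points
-- on distinct layers is an edge iff the indices of its low points increase with the layer and, if
-- all its points are low, its indices form an edge of S.  The formula φ(x; ȳ) says that x is
-- adjacent to every (k-1)-subset of ȳ lying on distinct layers, and the parameter for a (k-1)-set j
-- puts the values of j on every low layer and 0 on every high layer.  If x realises the parameters
-- of all j ∈ s and v ∈ [ω]^{n-1} witnesses s ∉ Δ, then x together with v on the low layers and 0 on
-- the high layers is an n'-clique.  Conversely, if s ∈ Δ, the vertex over finitely many base points
-- that is adjacent to exactly the (k-1)-sets whose low indices lie in a member of s creates no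
-- n'-clique, so it exists and realises all these parameters.
module Submission where

open import Defs
open import Data.Nat using (ℕ; _≤_; _<_; pred)
open import Data.Fin using (Fin)

open import Data.Bool using (Bool; true)
open import Data.Empty using (⊥; ⊥-elim)
import Data.Empty.Irrelevant as Irrelevant
open import Data.Fin using (toℕ; fromℕ<; punchIn; punchOut; inject≤; combine; remQuot)
  renaming (zero to fz; suc to fs; _<_ to _<F_; _≤_ to _≤F_)
import Data.Fin.Properties as Finₚ
open import Data.Fin.Properties
  using (toℕ-injective; toℕ<n; toℕ-fromℕ<; toℕ-inject≤; ¬Fin0; any?; all?; pigeonhole; injective⇒≤;
         punchIn-injective; punchInᵢ≢i; punchIn-mono-≤; punchOut-injective; punchIn-punchOut;
         combine-remQuot; remQuot-combine; combine-monoˡ-<)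
  renaming (_≟_ to _≟F_; _<?_ to _<?F_)
open import Data.List using (List; []; _∷_)
open import Data.List.Membership.Propositional using (_∈_)
open import Data.List.Relation.Unary.All as All using (All; lookupAny)
open import Data.List.Relation.Unary.Any as Any using (Any; here; there)
open import Data.Nat using (zero; suc; z≤n; s≤s; z<s; s<s; _+_; _*_; _∸_; _⊓_; _⊔_; _≤?_; _<?_)
open import Data.Nat.Properties
open import Data.Product using (∃; _×_; _,_; proj₁; proj₂; uncurry)
open import Data.Sum using (_⊎_; inj₁; inj₂; [_,_]′)
open import Data.Unit using (⊤; tt)
open import Function using (_∘_; id)
open import Function.Bundles using (_⇔_; mk⇔; Equivalence)
open import Relation.Binary using (tri<; tri≈; tri>)
open import Relation.Binary.PropositionalEquality
  using (_≡_; _≢_; refl; sym; trans; cong; cong₂; subst; subst₂; _≗_; module ≡-Reasoning)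
open import Relation.Nullary using (¬_; ¬?; Dec; does; yes; no; contradiction)
open import Relation.Nullary.Decidable using (_→-dec_; dec-true)

private
  variable
    A B C : Set
    a b c k m n : ℕ

-- Tuples and their images

infix 4 _⊆ᵢ_ _≅ᵢ_

_⊆ᵢ_ : (Fin a → A) → (Fin b → A) → Set
u ⊆ᵢ v = ∀ r → ∃ λ r' → u r ≡ v r'

_≅ᵢ_ : (Fin a → A) → (Fin b → A) → Set
u ≅ᵢ v = u ⊆ᵢ v × v ⊆ᵢ u

⊆ᵢ-trans : {u : Fin a → A} {v : Fin b → A} {w : Fin c → A} → u ⊆ᵢ v → v ⊆ᵢ w → u ⊆ᵢ w
⊆ᵢ-trans u⊆v v⊆w r with u⊆v r
... | r' , e with v⊆w r'
...   | r'' , e' = r'' , trans e e'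

≅ᵢ-sym : {u : Fin a → A} {v : Fin b → A} → u ≅ᵢ v → v ≅ᵢ u
≅ᵢ-sym (u⊆v , v⊆u) = v⊆u , u⊆v

≅ᵢ-trans : {u : Fin a → A} {v : Fin b → A} {w : Fin c → A} → u ≅ᵢ v → v ≅ᵢ w → u ≅ᵢ w
≅ᵢ-trans (u⊆v , v⊆u) (v⊆w , w⊆v) = ⊆ᵢ-trans u⊆v v⊆w , ⊆ᵢ-trans w⊆v v⊆u

≗⇒≅ᵢ : {u v : Fin a → A} → u ≗ v → u ≅ᵢ v
≗⇒≅ᵢ u≗v = (λ r → r , u≗v r) , (λ r → r , sym (u≗v r))

∘-⊆ᵢ : (g : A → B) {u : Fin a → A} {v : Fin b → A} → u ⊆ᵢ v → g ∘ u ⊆ᵢ g ∘ v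
∘-⊆ᵢ g u⊆v r = proj₁ (u⊆v r) , cong g (proj₂ (u⊆v r))

∘-≅ᵢ : (g : A → B) {u : Fin a → A} {v : Fin b → A} → u ≅ᵢ v → g ∘ u ≅ᵢ g ∘ v
∘-≅ᵢ g (u⊆v , v⊆u) = ∘-⊆ᵢ g u⊆v , ∘-⊆ᵢ g v⊆u

∘-⊆ᵢ⁻¹ : {g : A → B} → (∀ {x y} → g x ≡ g y → x ≡ y) →
  {u : Fin a → A} {v : Fin b → A} → g ∘ u ⊆ᵢ g ∘ v → u ⊆ᵢ v
∘-⊆ᵢ⁻¹ g-inj gu⊆gv r = proj₁ (gu⊆gv r) , g-inj (proj₂ (gu⊆gv r))

ext-≅ᵢ : {u : Fin a → A} {v : Fin b → A} (x : A) → u ≅ᵢ v → ext {suc a} x u ≅ᵢ ext {suc b} x v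
ext-≅ᵢ x (u⊆v , v⊆u) = extend u⊆v , extend v⊆u
  where
  extend : ∀ {a b} {u : Fin a → _} {v : Fin b → _} → u ⊆ᵢ v → ext {suc a} x u ⊆ᵢ ext {suc b} x v
  extend u⊆v fz = fz , refl
  extend u⊆v (fs r) = fs (proj₁ (u⊆v r)) , proj₂ (u⊆v r)

ext-injective : ∀ {x} {u : Fin k → A} → (∀ i → x ≢ u i) → Injective u → Injective (ext {suc k} x u)
ext-injective fresh u-inj fz fz _ = refl
ext-injective fresh u-inj fz (fs j) e = ⊥-elim (fresh j e)
ext-injective fresh u-inj (fs i) fz e = ⊥-elim (fresh i (sym e))
ext-injective fresh u-inj (fs i) (fs j) e = cong fs (u-inj i j e)

ext-cong : ∀ {x} {u v : Fin k → A} → u ≗ v → ext {suc k} x u ≗ ext x v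
ext-cong u≗v fz = refl
ext-cong u≗v (fs r) = u≗v r

ext-∘ : ∀ (g : A → B) {x} {u : Fin k → A} → g ∘ ext {suc k} x u ≗ ext (g x) (g ∘ u)
ext-∘ g fz = refl
ext-∘ g (fs r) = refl

≅ᵢ-punchIn : (h : Fin (suc a) → A) (r₀ : Fin (suc a)) → h ≅ᵢ ext (h r₀) (h ∘ punchIn r₀)
≅ᵢ-punchIn h r₀ = covered , λ { fz → r₀ , refl ; (fs q) → punchIn r₀ q , refl }
  where
  covered : h ⊆ᵢ ext (h r₀) (h ∘ punchIn r₀)
  covered r with r₀ ≟F r
  ... | yes refl = fz , refl
  ... | no r₀≢r = fs (punchOut r₀≢r) , cong h (sym (punchIn-punchOut r₀≢r))

<⇒missed : (h : Fin a → Fin m) → a < m → ∃ λ y → ∀ r → h r ≢ y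
<⇒missed {a} {m} h a<m with any? (λ y → ¬? (any? (λ r → h r ≟F y)))
... | yes (y , unhit) = y , λ r e → unhit (r , e)
... | no all-hit = contradiction (injective⇒≤ preimage-injective) (<⇒≱ a<m)
  where
  preimage : Fin m → Fin a
  preimage y with any? (λ r → h r ≟F y)
  ... | yes (r , _) = r
  ... | no unhit = ⊥-elim (all-hit (y , unhit))

  preimage-section : ∀ y → h (preimage y) ≡ y
  preimage-section y with any? (λ r → h r ≟F y)
  ... | yes (_ , e) = e
  ... | no unhit = ⊥-elim (all-hit (y , unhit))

  preimage-injective : ∀ {y y'} → preimage y ≡ preimage y' → y ≡ y'
  preimage-injective {y} {y'} e = trans (sym (preimage-section y)) (trans (cong h e) (preimage-section y'))

injective⇒surjective : (f : Fin n → Fin n) → Injective f → ∀ y → ∃ λ r → f r ≡ y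
injective⇒surjective {suc n} f f-inj y with any? (λ r → f r ≟F y)
... | yes hit = hit
... | no unhit = contradiction (injective⇒≤ punched-injective) 1+n≰n
  where
  avoids : ∀ r → y ≢ f r
  avoids r e = unhit (r , sym e)

  punched-injective : ∀ {r r'} → punchOut (avoids r) ≡ punchOut (avoids r') → r ≡ r'
  punched-injective {r} {r'} = f-inj r r' ∘ punchOut-injective (avoids r) (avoids r')

⊆ᵢ-injective : {u v : Fin a → A} → Injective u → u ⊆ᵢ v → Injective v
⊆ᵢ-injective {u = u} {v} u-inj u⊆v = v-inj
  where
  σ = proj₁ ∘ u⊆v

  u≡v∘σ : ∀ r → u r ≡ v (σ r)
  u≡v∘σ = proj₂ ∘ u⊆v

  onto : ∀ j → ∃ λ r → σ r ≡ j
  onto = injective⇒surjective σ λ r r' e →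
    u-inj r r' (trans (u≡v∘σ r) (trans (cong v e) (sym (u≡v∘σ r'))))

  v-inj : Injective v
  v-inj j j' e with onto j | onto j'
  ... | r , refl | r' , refl = cong σ (u-inj r r' (trans (u≡v∘σ r) (trans e (sym (u≡v∘σ r')))))

argmax : (d : Fin (suc n) → ℕ) → ∃ λ r₀ → ∀ r → d r ≤ d r₀
argmax {zero} d = fz , λ { fz → ≤-refl }
argmax {suc n} d with argmax (d ∘ fs)
... | r₁ , max₁ with d fz ≤? d (fs r₁)
...   | yes d0≤ = fs r₁ , λ { fz → d0≤ ; (fs r) → max₁ r }
...   | no d0≰ = fz , λ { fz → ≤-refl ; (fs r) → ≤-trans (max₁ r) (<⇒≤ (≰⇒> d0≰)) }

⨆ : (Fin m → ℕ) → ℕ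
⨆ {zero} _ = 0
⨆ {suc m} d = d fz ⊔ ⨆ (d ∘ fs)

≤-⨆ : (d : Fin m → ℕ) → ∀ i → d i ≤ ⨆ d
≤-⨆ d fz = m≤m⊔n _ _
≤-⨆ d (fs i) = ≤-trans (≤-⨆ (d ∘ fs) i) (m≤n⊔m _ _)

-- Increasing tuples

incN⇒injective : {h : Fin a → ℕ} → IncN h → Injective h
incN⇒injective h-inc i j e with <-cmp (toℕ i) (toℕ j)
... | tri< i<j _ _ = contradiction e (<⇒≢ (h-inc i j i<j))
... | tri≈ _ i≡j _ = toℕ-injective i≡j
... | tri> _ _ j<i = contradiction (sym e) (<⇒≢ (h-inc j i j<i))

incF⇒injective : {f : Fin a → Fin n} → IncF f → Injective f
incF⇒injective f-inc i j = incN⇒injective f-inc i j ∘ cong toℕ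

incN-reflects-< : {h : Fin a → ℕ} → IncN h → ∀ i j → h i < h j → i <F j
incN-reflects-< {h = h} h-inc i j hi<hj with <-cmp (toℕ i) (toℕ j)
... | tri< i<j _ _ = i<j
... | tri≈ _ i≡j _ = contradiction (cong h (toℕ-injective i≡j)) (<⇒≢ hi<hj)
... | tri> _ _ j<i = contradiction (h-inc j i j<i) (<⇒≯ hi<hj)

incN-mono-≤ : {h : Fin a → ℕ} → IncN h → ∀ i j → i ≤F j → h i ≤ h j
incN-mono-≤ h-inc i j i≤j with m≤n⇒m<n∨m≡n i≤j
... | inj₁ i<j = <⇒≤ (h-inc i j i<j)
... | inj₂ i≡j = ≤-reflexive (cong _ (toℕ-injective i≡j))

incF-tail-nonzero : {f : Fin (suc a) → Fin (suc n)} → IncF f → ∀ r → f (fs r) ≢ fz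
incF-tail-nonzero {f = f} f-inc r e = n≮0 (subst (λ y → toℕ (f fz) < toℕ y) e (f-inc fz (fs r) z<s))

punchIn-mono-< : ∀ (y : Fin (suc n)) {i j} → i <F j → punchIn y i <F punchIn y j
punchIn-mono-< y {i} {j} i<j =
  Finₚ.≤∧≢⇒< (punchIn-mono-≤ y i j (<⇒≤ i<j)) (Finₚ.<⇒≢ i<j ∘ punchIn-injective y i j)

module _ (y : Fin (suc n)) (f : Fin a → Fin (suc n)) (avoids : ∀ r → f r ≢ y) where

  punchOut* : Fin a → Fin n
  punchOut* r = punchOut (avoids r ∘ sym)

  punchIn-punchOut* : ∀ r → punchIn y (punchOut* r) ≡ f r
  punchIn-punchOut* r = punchIn-punchOut (avoids r ∘ sym)

  punchOut*-injective : Injective f → Injective punchOut*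
  punchOut*-injective f-inj i j e =
    f-inj i j (trans (sym (punchIn-punchOut* i)) (trans (cong (punchIn y) e) (punchIn-punchOut* j)))

  punchOut*-incF : IncF f → IncF punchOut*
  punchOut*-incF f-inc i j i<j =
    incN-reflects-< (λ _ _ → punchIn-mono-< y) _ _
      (subst₂ _<F_ (sym (punchIn-punchOut* i)) (sym (punchIn-punchOut* j)) (f-inc i j i<j))

incF-endo-≗id : (f : Fin n → Fin n) → IncF f → f ≗ id
incF-endo-≗id {suc n} f f-inc fz with injective⇒surjective f (incF⇒injective f-inc) fz
... | fz , f0≡0 = f0≡0
... | fs r , fr≡0 = contradiction fr≡0 (incF-tail-nonzero f-inc r)
incF-endo-≗id {suc n} f f-inc (fs r) =
  trans (sym (punchIn-punchOut* fz _ tail-nonzero r))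
        (cong fs (incF-endo-≗id _ (punchOut*-incF fz _ tail-nonzero (λ i j → f-inc _ _ ∘ s<s)) r))
  where
  tail-nonzero = incF-tail-nonzero f-inc

incN-⊆ᵢ⇒≗ : {u v : Fin a → ℕ} → IncN u → IncN v → u ⊆ᵢ v → u ≗ v
incN-⊆ᵢ⇒≗ {u = u} {v} u-inc v-inc u⊆v r = trans (proj₂ (u⊆v r)) (cong v (incF-endo-≗id τ τ-inc r))
  where
  τ = proj₁ ∘ u⊆v

  τ-inc : IncF τ
  τ-inc i j i<j = incN-reflects-< v-inc _ _ (subst₂ _<_ (proj₂ (u⊆v i)) (proj₂ (u⊆v j)) (u-inc i j i<j))

incF-⊆ᵢ⇒≗ : {u v : Fin a → Fin n} → IncF u → IncF v → u ⊆ᵢ v → u ≗ v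
incF-⊆ᵢ⇒≗ u-inc v-inc u⊆v = toℕ-injective ∘ incN-⊆ᵢ⇒≗ u-inc v-inc (∘-⊆ᵢ toℕ u⊆v)

sort : (h : Fin a → Fin m) → Injective h → ∃ λ (h' : Fin a → Fin m) → IncF h' × h ≅ᵢ h'
sort {zero} h _ = h , (λ ()) , ≗⇒≅ᵢ (λ ())
sort {suc a} {zero} h _ = ⊥-elim (¬Fin0 (h fz))
sort {a} {suc m} h h-inj with any? (λ r → h r ≟F fz)
... | no fz-unhit = fs ∘ h₀ , (λ i j → s<s ∘ h₀-inc i j) , image
  where
  nonzero : ∀ r → h r ≢ fz
  nonzero r e = fz-unhit (r , e)

  sorted = sort (punchOut* fz h nonzero) (punchOut*-injective fz h nonzero h-inj)
  h₀ = proj₁ sorted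
  h₀-inc = proj₁ (proj₂ sorted)

  image : h ≅ᵢ fs ∘ h₀
  image = ≅ᵢ-trans (≗⇒≅ᵢ (sym ∘ punchIn-punchOut* fz h nonzero))
                   (∘-≅ᵢ fs (proj₂ (proj₂ sorted)))
sort {suc a} {suc m} h h-inj | yes (r₀ , hr₀≡0) = ext fz (fs ∘ h₀) , increasing , image
  where
  rest = h ∘ punchIn r₀

  nonzero : ∀ q → rest q ≢ fz
  nonzero q e = punchInᵢ≢i r₀ q (h-inj _ _ (trans e (sym hr₀≡0)))

  sorted = sort (punchOut* fz rest nonzero)
                (punchOut*-injective fz rest nonzero (λ i j → punchIn-injective r₀ i j ∘ h-inj _ _))
  h₀ = proj₁ sorted
  h₀-inc = proj₁ (proj₂ sorted)

  increasing : IncF (ext fz (fs ∘ h₀))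
  increasing fz (fs j) _ = z<s
  increasing (fs i) (fs j) (s<s i<j) = s<s (h₀-inc i j i<j)

  image : h ≅ᵢ ext fz (fs ∘ h₀)
  image = ≅ᵢ-trans (≅ᵢ-punchIn h r₀)
            (≅ᵢ-trans (≗⇒≅ᵢ λ { fz → hr₀≡0
                               ; (fs q) → sym (punchIn-punchOut* fz rest nonzero q) })
                      (ext-≅ᵢ fz (∘-≅ᵢ fs (proj₂ (proj₂ sorted)))))

incF-cover : (h : Fin a → Fin n) → Injective h → a ≤ b → b ≤ n →
  ∃ λ (g : Fin b → Fin n) → IncF g × h ⊆ᵢ g
incF-cover {n = zero} h _ _ z≤n = (λ ()) , (λ ()) , ⊥-elim ∘ ¬Fin0 ∘ h
incF-cover {n = suc n} h h-inj a≤b b≤1+n with m≤n⇒m<n∨m≡n b≤1+n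
... | inj₂ refl = id , (λ _ _ i<j → i<j) , λ r → h r , refl
... | inj₁ (s≤s b≤n) with <⇒missed h (s≤s (≤-trans a≤b b≤n))
...   | y , unhit with incF-cover (punchOut* y h unhit) (punchOut*-injective y h unhit h-inj) a≤b b≤n
...     | g , g-inc , h⊆g =
  punchIn y ∘ g ,
  (λ i j → punchIn-mono-< y ∘ g-inc i j) ,
  λ r → proj₁ (h⊆g r) ,
        trans (sym (punchIn-punchOut* y h unhit r)) (cong (punchIn y) (proj₂ (h⊆g r)))

pair-injective : ∀ {i j : A} → i ≢ j → Injective (ext {2} i (ext {1} j λ ()))
pair-injective i≢j fz fz _ = refl
pair-injective i≢j fz (fs fz) e = ⊥-elim (i≢j e)
pair-injective i≢j (fs fz) fz e = ⊥-elim (i≢j (sym e))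
pair-injective i≢j (fs fz) (fs fz) _ = refl

incF-through-pair : ∀ {i j : Fin n} → i ≢ j → 2 ≤ b → b ≤ n →
  ∃ λ (g : Fin b → Fin n) → IncF g × (∃ λ p → i ≡ g p) × (∃ λ p → j ≡ g p)
incF-through-pair i≢j 2≤b b≤n with incF-cover _ (pair-injective i≢j) 2≤b b≤n
... | g , g-inc , pair⊆g = g , g-inc , pair⊆g fz , pair⊆g (fs fz)

incF-through : (i : Fin n) → 1 ≤ b → b ≤ n →
  ∃ λ (g : Fin b → Fin n) → IncF g × ∃ λ p → i ≡ g p
incF-through i 1≤b b≤n with incF-cover (λ (_ : Fin 1) → i) (λ { fz fz _ → refl }) 1≤b b≤n
... | g , g-inc , i⊆g = g , g-inc , i⊆g fz

-- g r = min (h r) (n ∸ b + r) keeps the values of h below n in place and pushes the others up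
-- into the last free slots.
squeeze : b ≤ n → (h : Fin b → ℕ) → IncN h →
  ∃ λ (g : Fin b → Fin n) → IncF g × (∀ r → h r < n → ∃ λ t → toℕ (g t) ≡ h r)
squeeze {b} {n} b≤n h h-inc = g , g-inc , covers
  where
  gap = n ∸ b

  value : Fin b → ℕ
  value r = h r ⊓ (gap + toℕ r)

  value<n : ∀ r → value r < n
  value<n r = ≤-<-trans (m⊓n≤n (h r) _)
                        (subst (gap + toℕ r <_) (m∸n+n≡m b≤n) (+-monoʳ-< gap (toℕ<n r)))

  g : Fin b → Fin n
  g r = fromℕ< (value<n r)

  g-inc : IncF g
  g-inc i j i<j = subst₂ _<_ (sym (toℕ-fromℕ< (value<n i))) (sym (toℕ-fromℕ< (value<n j)))
                         (⊓-mono-< (h-inc i j i<j) (+-monoʳ-< gap i<j))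

  covers : ∀ r → h r < n → ∃ λ t → toℕ (g t) ≡ h r
  covers r hr<n with h r ≤? gap + toℕ r
  ... | yes hr≤ = r , trans (toℕ-fromℕ< (value<n r)) (m≤n⇒m⊓n≡m hr≤)
  ... | no hr≰ = t , gt≡hr
    where
    gap+r<hr : gap + toℕ r < h r
    gap+r<hr = ≰⇒> hr≰

    gap+d≡hr : gap + (h r ∸ gap) ≡ h r
    gap+d≡hr = m+[n∸m]≡n (≤-trans (m≤m+n gap (toℕ r)) (<⇒≤ gap+r<hr))

    d<b : h r ∸ gap < b
    d<b = +-cancelˡ-< gap _ _ (subst₂ _<_ (sym gap+d≡hr) (sym (m∸n+n≡m b≤n)) hr<n)

    t = fromℕ< d<b

    r≤t : toℕ r ≤ toℕ t
    r≤t = subst (toℕ r ≤_) (sym (toℕ-fromℕ< d<b))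
            (<⇒≤ (+-cancelˡ-< gap _ _ (subst (gap + toℕ r <_) (sym gap+d≡hr) gap+r<hr)))

    gt≡hr : toℕ (g t) ≡ h r
    gt≡hr = begin
      toℕ (g t)                 ≡⟨ toℕ-fromℕ< (value<n t) ⟩
      h t ⊓ (gap + toℕ t)       ≡⟨ cong (λ d → h t ⊓ (gap + d)) (toℕ-fromℕ< d<b) ⟩
      h t ⊓ (gap + (h r ∸ gap)) ≡⟨ cong (h t ⊓_) gap+d≡hr ⟩
      h t ⊓ h r                 ≡⟨ m≥n⇒m⊓n≡n (incN-mono-≤ h-inc r t r≤t) ⟩
      h r                       ∎
      where open ≡-Reasoning

remQuot-mono : ∀ k {y y' : Fin (m * k)} → y <F y' → proj₁ (remQuot {m} k y) ≤F proj₁ (remQuot k y')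
remQuot-mono {m} k {y} {y'} y<y' = ≮⇒≥ λ ℓ'<ℓ →
  <⇒≯ y<y' (subst₂ _<F_ (combine-remQuot {m} k y') (combine-remQuot {m} k y) (combine-monoˡ-< _ _ ℓ'<ℓ))

-- Uniform hypergraphs

uniform-by-≅ᵢ : {R : (Fin k → C) → Set} →
  (∀ u → R u → Injective u) → (∀ {u v} → R u → u ≅ᵢ v → R v) → IsUniformHypergraph k C R
uniform-by-≅ᵢ irreflexive symmetric =
  irreflexive , λ u v Ru u⊆v v⊆u → symmetric Ru (u⊆v , λ j → proj₁ (v⊆u j) , sym (proj₂ (v⊆u j)))

module _ {R : (Fin k → C) → Set} (R-uniform : IsUniformHypergraph k C R) where

  resp-≅ᵢ : ∀ {u v} → R u → u ≅ᵢ v → R v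
  resp-≅ᵢ Ru (u⊆v , v⊆u) =
    proj₂ R-uniform _ _ Ru u⊆v (λ j → proj₁ (v⊆u j) , sym (proj₂ (v⊆u j)))

  resp-≗ : ∀ {u v} → R u → u ≗ v → R v
  resp-≗ Ru = resp-≅ᵢ Ru ∘ ≗⇒≅ᵢ

  clique-edges : ∀ {w : Fin m → C} → IsClique k R m w → (h : Fin k → Fin m) → Injective h → R (w ∘ h)
  clique-edges {w = w} (_ , edges) h h-inj with sort h h-inj
  ... | h' , h'-inc , h≅h' = resp-≅ᵢ (edges h' h'-inc) (∘-≅ᵢ w (≅ᵢ-sym h≅h'))

cone : ∀ {R : (Fin (suc k) → C) → Set} {x} {w : Fin n → C} → IsUniformHypergraph (suc k) C R →
  IsClique (suc k) R n w → (∀ i → x ≢ w i) → (∀ t → IncF t → R (ext x (w ∘ t))) →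
  IsClique (suc k) R (suc n) (ext x w)
cone {R = R} {x} {w} R-uniform (w-inj , w-edges) fresh x-edges = ext-injective fresh w-inj , edges
  where
  edges : ∀ f → IncF f → R (ext x w ∘ f)
  edges f f-inc with f fz ≟F fz
  ... | yes f0≡0 =
    resp-≗ R-uniform (x-edges _ (punchOut*-incF fz (f ∘ fs) tail-nonzero (λ i j → f-inc _ _ ∘ s<s)))
      λ { fz → cong (ext x w) (sym f0≡0)
        ; (fs r) → cong (ext x w) (punchIn-punchOut* fz (f ∘ fs) tail-nonzero r) }
    where
    tail-nonzero = incF-tail-nonzero f-inc
  ... | no f0≢0 =
    resp-≗ R-uniform (w-edges _ (punchOut*-incF fz f nonzero f-inc))
                     (cong (ext x w) ∘ punchIn-punchOut* fz f nonzero)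
    where
    nonzero : ∀ r → f r ≢ fz
    nonzero fz = f0≢0
    nonzero (fs r) = incF-tail-nonzero f-inc r

-- Without function extensionality a predicate on tuples need not respect pointwise equality of
-- tuples; the extension property of a random hypergraph provides this for increasing tuples.
TupleExtensionality : ℕ → Set
TupleExtensionality k1 =
  ∀ {m} (P : (Fin k1 → Fin m) → Bool) {t t'} →
  IncF t → IncF t' → t ≗ t' → P t ≡ true → P t' ≡ true

random⇒tupleExtensionality : ∀ {k1} {S : (Fin (suc k1) → ℕ) → Set} →
  IsRandomHypergraphOnℕ (suc k1) S → TupleExtensionality k1
random⇒tupleExtensionality (S-uniform , S-ext) {m} P {t} {t'} t-inc t'-inc t≗t' Pt
  with S-ext m toℕ (λ i j → toℕ-injective) P tt
... | _ , _ , adjacency =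
  Equivalence.to (adjacency t' t'-inc)
    (resp-≗ S-uniform (Equivalence.from (adjacency t t-inc) Pt) (ext-cong (cong toℕ ∘ t≗t')))

-- The free completion of a K_{n'}-free hypergraph

module FreeCompletion
  (k1 n1' : ℕ) (2≤K : 2 ≤ suc k1) (K≤n' : suc k1 ≤ suc n1')
  {X : Set} (E : (Fin (suc k1) → X) → Set)
  (E-uniform : IsUniformHypergraph (suc k1) X E) (E-free : CliqueFree (suc k1) E (suc n1'))
  (tupleExt : TupleExtensionality k1)
  where

  K n' : ℕ
  K = suc k1
  n' = suc n1'

  data Term : Set where
    base : X → Term
    new  : (m : ℕ) → (Fin m → Term) → ((Fin k1 → Fin m) → Bool) → Term

  base-injective : ∀ {x y} → base x ≡ base y → x ≡ y
  base-injective refl = refl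

  depth : Term → ℕ
  depth (base _) = 0
  depth (new m A P) = suc (⨆ λ i → depth (A i))

  depth-< : ∀ {m A P} i → depth (A i) < depth (new m A P)
  depth-< {A = A} i = s≤s (≤-⨆ (λ j → depth (A j)) i)

  new≢ : ∀ {m A P} i → new m A P ≢ A i
  new≢ {P = P} i e = <-irrefl (cong depth (sym e)) (depth-< {P = P} i)

  data Canonical : (Fin K → Term) → Set where
    base : ∀ {e} → E e → Canonical (base ∘ e)
    new  : ∀ {m A P t} → IncF t → P t ≡ true → Canonical (ext (new m A P) (A ∘ t))

  -- Defining edges up to image makes symmetry automatic.
  Edge : (Fin K → Term) → Set
  Edge c = Injective c × ∃ λ d → Canonical d × c ≅ᵢ d

  Edge-resp-≅ᵢ : ∀ {c c'} → Edge c → c ≅ᵢ c' → Edge c'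
  Edge-resp-≅ᵢ (c-inj , d , d-can , c≅d) c≅c' =
    ⊆ᵢ-injective c-inj (proj₁ c≅c') , d , d-can , ≅ᵢ-trans (≅ᵢ-sym c≅c') c≅d

  Edge-resp-≗ : ∀ {c c'} → Edge c → c ≗ c' → Edge c'
  Edge-resp-≗ edge = Edge-resp-≅ᵢ edge ∘ ≗⇒≅ᵢ

  Edge-base← : ∀ {e} → E e → Edge (base ∘ e)
  Edge-base← e-edge =
    (λ i j → proj₁ E-uniform _ e-edge i j ∘ base-injective) , _ , base e-edge , ≗⇒≅ᵢ (λ _ → refl)

  Edge-base→ : ∀ {e} → Edge (base ∘ e) → E e
  Edge-base→ (_ , _ , base e'-edge , e⊆e' , e'⊆e) =
    resp-≅ᵢ E-uniform e'-edge (∘-⊆ᵢ⁻¹ base-injective e'⊆e , ∘-⊆ᵢ⁻¹ base-injective e⊆e')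
  Edge-base→ (_ , _ , new _ _ , _ , d⊆c) with d⊆c fz
  ... | _ , ()

  Edge-new← : ∀ {m A P t} → Injective A → IncF t → P t ≡ true → Edge (ext (new m A P) (A ∘ t))
  Edge-new← A-inj t-inc Pt =
    ext-injective (new≢ ∘ _) (λ i j → incF⇒injective t-inc i j ∘ A-inj _ _) ,
    _ , new t-inc Pt , ≗⇒≅ᵢ (λ _ → refl)

  Edge-at-deepest : ∀ {c p m A P} → Edge c → c p ≡ new m A P →
    (∀ p' → depth (c p') ≤ depth (new m A P)) →
    ∃ λ t → IncF t × P t ≡ true × c ≅ᵢ ext (new m A P) (A ∘ t)
  Edge-at-deepest {p = p} (_ , _ , base _ , c⊆d , _) cp≡new _ with c⊆d p
  ... | _ , cp≡base with trans (sym cp≡new) cp≡base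
  ...   | ()
  Edge-at-deepest {p = p} (_ , _ , new {t = t} t-inc Pt , c≅d) cp≡new deepest with proj₁ c≅d p
  ... | fz , cp≡head with trans (sym cp≡new) cp≡head
  ...   | refl = t , t-inc , Pt , c≅d
  Edge-at-deepest (_ , _ , new {P = P'} {t} _ _ , c≅d) cp≡new deepest | fs l , cp≡tail
    with proj₂ c≅d fz
  ... | p' , head≡cp' = contradiction (deepest p') (<⇒≱ deeper)
    where
    deeper = subst₂ _<_ (cong depth (trans (sym cp≡tail) cp≡new)) (cong depth head≡cp')
                        (depth-< {P = P'} (t l))

  Edge-new→ : ∀ {m A P t} → Injective A → IncF t → Edge (ext (new m A P) (A ∘ t)) → P t ≡ true
  Edge-new→ {m} {A} {P} {t} A-inj t-inc edge = tupleExt P t'-inc t-inc (sym ∘ t≗t') Pt'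
    where
    deepest : ∀ p → depth (ext (new m A P) (A ∘ t) p) ≤ depth (new m A P)
    deepest fz = ≤-refl
    deepest (fs l) = <⇒≤ (depth-< {P = P} (t l))

    at-head = Edge-at-deepest {p = fz} edge refl deepest
    t' = proj₁ at-head
    t'-inc = proj₁ (proj₂ at-head)
    Pt' = proj₁ (proj₂ (proj₂ at-head))

    t⊆t' : t ⊆ᵢ t'
    t⊆t' l with proj₁ (proj₂ (proj₂ (proj₂ at-head))) (fs l)
    ... | fz , e = ⊥-elim (new≢ (t l) (sym e))
    ... | fs l' , e = l' , A-inj _ _ e

    t≗t' = incF-⊆ᵢ⇒≗ t-inc t'-inc t⊆t'

  Valid : Term → Set
  Valid (base _) = ⊤
  Valid (new m A P) = Injective A × NoNewClique K Edge n' m A P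

  -- Validity is irrelevant, so that vertices with equal terms are equal.
  record Vertex : Set where
    constructor vertex
    field
      term : Term
      .valid : Valid term

  open Vertex

  term-injective : ∀ {u v : Vertex} → term u ≡ term v → u ≡ v
  term-injective {vertex _ _} {vertex _ _} refl = refl

  R : (Fin K → Vertex) → Set
  R c = Edge (term ∘ c)

  R-uniform : IsUniformHypergraph K Vertex R
  R-uniform =
    uniform-by-≅ᵢ (λ c Rc i j → proj₁ Rc i j ∘ cong term) (λ Rc → Edge-resp-≅ᵢ Rc ∘ ∘-≅ᵢ term)

  shallow⇒base : ∀ T → depth T ≤ 0 → ∃ λ x → T ≡ base x
  shallow⇒base (base x) _ = x , refl

  shallow-clique⇒⊥ : ∀ {w} → IsClique K R n' w → (∀ r → depth (term (w r)) ≤ 0) → ⊥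
  shallow-clique⇒⊥ {w} (w-inj , w-edges) shallow = E-free x (x-inj , x-edges)
    where
    x : Fin n' → X
    x r = proj₁ (shallow⇒base _ (shallow r))

    w≡base : ∀ r → term (w r) ≡ base (x r)
    w≡base r = proj₂ (shallow⇒base _ (shallow r))

    x-inj : Injective x
    x-inj i j e = w-inj i j (term-injective (trans (w≡base i) (trans (cong base e) (sym (w≡base j)))))

    x-edges : ∀ f → IncF f → E (x ∘ f)
    x-edges f f-inc = Edge-base→ (Edge-resp-≗ (w-edges f f-inc) (w≡base ∘ f))

  -- Every edge of the clique through its deepest vertex `new m A P` is a canonical edge of that
  -- vertex, so the other vertices of the clique lie in A, and sorted they form the clique inside A
  -- that the validity of `new m A P` forbids.
  module DeepestVertex {w : Fin n' → Vertex} (clique : IsClique K R n' w)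
    {r₀} (deepest : ∀ r → depth (term (w r)) ≤ depth (term (w r₀)))
    {m A P} (top : term (w r₀) ≡ new m A P) (A-inj : Injective A) where

    W : Fin n' → Term
    W = term ∘ w

    W-inj : Injective W
    W-inj i j = proj₁ clique i j ∘ term-injective

    others-in-A : ∀ q → ∃ λ y → W (punchIn r₀ q) ≡ A y
    others-in-A q with incF-through-pair (punchInᵢ≢i r₀ q ∘ sym) 2≤K K≤n'
    ... | f , f-inc , (p₀ , r₀≡fp₀) , (p₁ , rq≡fp₁)
      with Edge-at-deepest (proj₂ clique f f-inc) (trans (cong W (sym r₀≡fp₀)) top)
             (λ p → subst (λ T → depth (W (f p)) ≤ depth T) top (deepest (f p)))
    ...   | t , _ , _ , c⊆d , _ with c⊆d p₁
    ...     | fz , e = ⊥-elim (punchInᵢ≢i r₀ q (W-inj _ _ (trans (cong W rq≡fp₁) (trans e (sym top)))))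
    ...     | fs l , e = t l , trans (cong W rq≡fp₁) e

    ι : Fin n1' → Fin m
    ι = proj₁ ∘ others-in-A

    ι-inj : Injective ι
    ι-inj q q' e = punchIn-injective r₀ q q'
      (W-inj _ _ (trans (proj₂ (others-in-A q)) (trans (cong A e) (sym (proj₂ (others-in-A q'))))))

    sorted = sort ι ι-inj
    w₀ = proj₁ sorted
    w₀-inc = proj₁ (proj₂ sorted)
    w₀⊆ι = proj₂ (proj₂ (proj₂ sorted))

    κ : Fin n1' → Fin n'
    κ q = punchIn r₀ (proj₁ (w₀⊆ι q))

    A∘w₀≡W∘κ : ∀ q → A (w₀ q) ≡ W (κ q)
    A∘w₀≡W∘κ q = trans (cong A (proj₂ (w₀⊆ι q))) (sym (proj₂ (others-in-A _)))

    κ-inj : Injective κ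
    κ-inj q q' e = incF⇒injective w₀-inc q q'
      (A-inj _ _ (trans (A∘w₀≡W∘κ q) (trans (cong W e) (sym (A∘w₀≡W∘κ q')))))

    edges-in-A : ∀ f → IncF f → Edge (λ i → A (w₀ (f i)))
    edges-in-A f f-inc =
      Edge-resp-≗ (clique-edges R-uniform clique (κ ∘ f) (λ i j → incF⇒injective f-inc i j ∘ κ-inj _ _))
                  (sym ∘ A∘w₀≡W∘κ ∘ f)

    selected-in-A : ∀ g → IncF g → P (λ i → w₀ (g i)) ≡ true
    selected-in-A g g-inc = Edge-new→ A-inj (λ i j → w₀-inc _ _ ∘ g-inc i j) (Edge-resp-≗ edge pointwise)
      where
      edge = clique-edges R-uniform clique (ext r₀ (κ ∘ g))
               (ext-injective (λ i → punchInᵢ≢i r₀ _ ∘ sym)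
                              (λ i j → incF⇒injective g-inc i j ∘ κ-inj _ _))

      pointwise : W ∘ ext r₀ (κ ∘ g) ≗ ext (new m A P) (A ∘ w₀ ∘ g)
      pointwise fz = top
      pointwise (fs l) = sym (A∘w₀≡W∘κ (g l))

    new-clique : ¬ NoNewClique K Edge n' m A P
    new-clique no-new-clique = no-new-clique w₀ w₀-inc selected-in-A edges-in-A

  cliqueFree : CliqueFree K R n'
  cliqueFree w clique with argmax (depth ∘ term ∘ w)
  ... | r₀ , deepest = classify (w r₀) refl
    where
    classify : (v : Vertex) → w r₀ ≡ v → ⊥
    classify (vertex (base _) _) e =
      shallow-clique⇒⊥ clique λ r → subst (λ v → depth (term (w r)) ≤ depth (term v)) e (deepest r)
    classify (vertex (new m A P) valid) e =
      Irrelevant.⊥-elim (DeepestVertex.new-clique clique deepest (cong term e) (proj₁ valid) (proj₂ valid))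

  extension : ExtensionProperty K Vertex R (NoNewClique K R n')
  extension m a a-inj P allowed = newVertex , fresh , adjacency
    where
    terms-inj : Injective (term ∘ a)
    terms-inj i j = a-inj i j ∘ term-injective

    newVertex = vertex (new m (term ∘ a) P) (terms-inj , allowed)

    fresh : ∀ i → newVertex ≢ a i
    fresh i = new≢ i ∘ cong term

    adjacency : ∀ t → IncF t → R (ext newVertex (a ∘ t)) ⇔ (P t ≡ true)
    adjacency t t-inc =
      mk⇔ (λ edge → Edge-new→ terms-inj t-inc (Edge-resp-≗ edge (ext-∘ term)))
          (λ Pt → Edge-resp-≗ (Edge-new← terms-inj t-inc Pt) (sym ∘ ext-∘ term {newVertex} {a ∘ t}))

  isModel : IsModelT n' K Vertex R
  isModel = R-uniform , cliqueFree , extension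

  embed : X → Vertex
  embed x = vertex (base x) tt

  embed-injective : ∀ {x y} → embed x ≡ embed y → x ≡ y
  embed-injective = base-injective ∘ cong term

  R-embed : ∀ {e} → R (embed ∘ e) ⇔ E e
  R-embed = mk⇔ Edge-base→ Edge-base←

-- The layered base hypergraph

module Layered (k1 n1 n1' : ℕ)
  (S : (Fin (suc k1) → ℕ) → Set) (S-uniform : IsUniformHypergraph (suc k1) ℕ S) where

  Point : Set
  Point = Fin n1' × ℕ

  layer : Point → Fin n1'
  layer = proj₁

  index : Point → ℕ
  index = proj₂

  Low : Fin n1' → Set
  Low ℓ = toℕ ℓ < n1

  ifLow : ∀ {B : Set} (ℓ : Fin n1') → (Low ℓ → B) → B → B
  ifLow ℓ f d with toℕ ℓ <? n1
  ... | yes low = f low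
  ... | no _ = d

  ifLow-low : ∀ {B : Set} {ℓ} {f : Low ℓ → B} {d} (low : Low ℓ) → ifLow ℓ f d ≡ f low
  ifLow-low {ℓ = ℓ} {f} low with toℕ ℓ <? n1
  ... | yes low' = cong f (<-irrelevant low' low)
  ... | no high = contradiction low high

  ifLow-cong : ∀ {B : Set} {ℓ} {f f' : Low ℓ → B} {d} →
    (∀ low → f low ≡ f' low) → ifLow ℓ f d ≡ ifLow ℓ f' d
  ifLow-cong {ℓ = ℓ} f≗f' with toℕ ℓ <? n1
  ... | yes low = f≗f' low
  ... | no _ = refl

  ifLow-≤ : ∀ {ℓ} {f : Low ℓ → ℕ} {d b} → (∀ low → f low ≤ b) → d ≤ b → ifLow ℓ f d ≤ b
  ifLow-≤ {ℓ} f≤ d≤ with toℕ ℓ <? n1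
  ... | yes low = f≤ low
  ... | no _ = d≤

  Ordered : Point → Point → Set
  Ordered x y = layer x <F layer y → Low (layer y) → index x < index y

  LayeredEdge : (Fin (suc k1) → Point) → Set
  LayeredEdge e =
    Injective (layer ∘ e) ×
    (∀ r r' → Ordered (e r) (e r')) ×
    ((∀ r → Low (layer (e r))) → S (index ∘ e))

  LayeredEdge-uniform : IsUniformHypergraph (suc k1) Point LayeredEdge
  LayeredEdge-uniform = uniform-by-≅ᵢ (λ e (layers-inj , _) i j → layers-inj i j ∘ cong layer) symmetric
    where
    symmetric : ∀ {e e'} → LayeredEdge e → e ≅ᵢ e' → LayeredEdge e'
    symmetric {e} {e'} (layers-inj , ordered , low⇒S) e≅e'@(e⊆e' , e'⊆e) =
      ⊆ᵢ-injective layers-inj (∘-⊆ᵢ layer e⊆e') , ordered' , low⇒S'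
      where
      ordered' : ∀ r r' → Ordered (e' r) (e' r')
      ordered' r r' rewrite proj₂ (e'⊆e r) | proj₂ (e'⊆e r') = ordered _ _

      low⇒S' : (∀ r → Low (layer (e' r))) → S (index ∘ e')
      low⇒S' all-low = resp-≅ᵢ S-uniform (low⇒S all-low') (∘-≅ᵢ index e≅e')
        where
        all-low' : ∀ r → Low (layer (e r))
        all-low' r rewrite proj₂ (e⊆e' r) = all-low _

  layered-pair : 2 ≤ suc k1 → suc k1 ≤ n →
    (u : Fin n → Point) → (∀ f → IncF f → LayeredEdge (u ∘ f)) →
    ∀ {r r'} → r ≢ r' → layer (u r) ≢ layer (u r') × Ordered (u r) (u r')
  layered-pair 2≤K K≤n u edges r≢r' with incF-through-pair r≢r' 2≤K K≤n
  ... | f , f-inc , (p , refl) , (p' , refl) =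
    (λ e → r≢r' (cong f (proj₁ (edges f f-inc) p p' e))) , proj₁ (proj₂ (edges f f-inc)) p p'

  LayeredEdge-cliqueFree : 2 ≤ suc k1 → suc k1 ≤ suc n1' → CliqueFree (suc k1) LayeredEdge (suc n1')
  LayeredEdge-cliqueFree 2≤K K≤n' w (_ , w-edges) with pigeonhole ≤-refl (layer ∘ w)
  ... | r , r' , r<r' , same-layer = proj₁ (layered-pair 2≤K K≤n' w w-edges (Finₚ.<⇒≢ r<r')) same-layer

-- Finite conjunctions

verum : ∀ {V} → Formula k V
verum = neg falsum

⋀ : ∀ {V} m → (Fin m → Formula k V) → Formula k V
⋀ zero _ = verum
⋀ (suc m) G = and (G fz) (⋀ m (G ∘ fs))

⋀ⁿ : ∀ {V} a {q} → ((Fin a → Fin q) → Formula k V) → Formula k V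
⋀ⁿ zero G = G λ ()
⋀ⁿ (suc a) {q} G = ⋀ q λ y → ⋀ⁿ a λ σ → G (ext y σ)

guarded : ∀ {V} {B : Set} → Dec B → Formula k V → Formula k V
guarded (yes _) ψ = ψ
guarded (no _) _ = verum

module _ {R : (Fin k → C) → Set} {V : Set} {ρ : V → C} where

  private
    ⊨_ : Formula k V → Set
    ⊨ ψ = Sat C R ψ ρ

  ⋀-intro : ∀ m {G} → (∀ y → ⊨ G y) → ⊨ ⋀ m G
  ⋀-intro zero _ = λ ()
  ⋀-intro (suc m) sats = sats fz , ⋀-intro m (sats ∘ fs)

  ⋀-elim : ∀ m {G} → ⊨ ⋀ m G → ∀ y → ⊨ G y
  ⋀-elim (suc m) (sat , _) fz = sat
  ⋀-elim (suc m) (_ , sat) (fs y) = ⋀-elim m sat y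

  ⋀ⁿ-intro : ∀ a {q G} → (∀ σ → ⊨ G σ) → ⊨ ⋀ⁿ a {q} G
  ⋀ⁿ-intro zero sats = sats _
  ⋀ⁿ-intro (suc a) {q} sats = ⋀-intro q λ y → ⋀ⁿ-intro a (sats ∘ ext y)

  -- ⋀ⁿ only has a conjunct for the rebuilt tuple `ext (σ fz) (σ ∘ fs)`, which is σ only pointwise.
  ⋀ⁿ-elim : ∀ a {q G} → (∀ {σ σ'} → σ ≗ σ' → ⊨ G σ → ⊨ G σ') →
    ⊨ ⋀ⁿ a {q} G → ∀ σ → ⊨ G σ
  ⋀ⁿ-elim zero G-cong sat σ = G-cong (λ ()) sat
  ⋀ⁿ-elim (suc a) {q} G-cong sat σ =
    G-cong (λ { fz → refl ; (fs r) → refl })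
           (⋀ⁿ-elim a (G-cong ∘ ext-cong) (⋀-elim q sat (σ fz)) (σ ∘ fs))

  guarded-intro : ∀ {B : Set} {d : Dec B} {ψ} → (B → ⊨ ψ) → ⊨ guarded d ψ
  guarded-intro {d = yes b} sat = sat b
  guarded-intro {d = no _} _ = λ ()

  guarded-elim : ∀ {B : Set} {d : Dec B} {ψ} → ⊨ guarded d ψ → B → ⊨ ψ
  guarded-elim {d = yes _} sat _ = sat
  guarded-elim {d = no ¬b} _ b = contradiction b ¬b

-- The pattern

module Pattern (k2 n1 n1' : ℕ) (K≤n1 : suc (suc k2) ≤ n1) (n1≤n1' : n1 ≤ n1')
  (S : (Fin (suc (suc k2)) → ℕ) → Set) (S-random : IsRandomHypergraphOnℕ (suc (suc k2)) S) where

  k1 : ℕ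
  k1 = suc k2

  2≤K : 2 ≤ suc k1
  2≤K = s≤s (s≤s z≤n)

  k1≤n1 : k1 ≤ n1
  k1≤n1 = ≤-trans (n≤1+n k1) K≤n1

  K≤n1' : suc k1 ≤ n1'
  K≤n1' = ≤-trans K≤n1 n1≤n1'

  K≤n' : suc k1 ≤ suc n1'
  K≤n' = ≤-trans K≤n1' (n≤1+n n1')

  open Layered k1 n1 n1' S (proj₁ S-random)

  module Model = FreeCompletion k1 n1' 2≤K K≤n' LayeredEdge LayeredEdge-uniform
    (LayeredEdge-cliqueFree 2≤K K≤n') (random⇒tupleExtensionality S-random)
  open Model using (K; n'; Vertex; R; R-uniform; cliqueFree; extension; embed; embed-injective; R-embed)

  -- The variables ȳ are indexed by (layer, position) pairs through remQuot.
  q : ℕ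
  q = n1' * k1

  layerOf : Fin q → Fin n1'
  layerOf y = proj₁ (remQuot {n1'} k1 y)

  pointOf : Subsets k1 → Fin n1' × Fin k1 → Point
  pointOf j (ℓ , p) = ℓ , ifLow ℓ (λ _ → proj₁ j p) 0

  param : Subsets k1 → Fin q → Vertex
  param j y = embed (pointOf j (remQuot {n1'} k1 y))

  Selected : (Fin k1 → Fin q) → Set
  Selected σ = IncF (layerOf ∘ σ)

  selected? : ∀ σ → Dec (Selected σ)
  selected? σ = all? λ i → all? λ j → (i <?F j) →-dec (layerOf (σ i) <?F layerOf (σ j))

  atom : (Fin k1 → Fin q) → Formula K (Fin 1 ⊎ Fin q)
  atom σ = guarded (selected? σ) (rel (ext (inj₁ fz) (inj₂ ∘ σ)))

  φ : Formula K (Fin 1 ⊎ Fin q)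
  φ = ⋀ⁿ k1 atom

  Realises : (Fin 1 → Vertex) → Subsets k1 → Set
  Realises x j = Sat Vertex R φ [ x , param j ]′

  realises-intro : ∀ {x j} → (∀ σ → Selected σ → R (ext (x fz) (param j ∘ σ))) → Realises x j
  realises-intro {x} {j} adjacent =
    ⋀ⁿ-intro k1 {G = atom} λ σ → guarded-intro {d = selected? σ} λ sel →
      resp-≗ R-uniform (adjacent σ sel) (sym ∘ ext-∘ [ x , param j ]′ {inj₁ fz} {inj₂ ∘ σ})

  realises-elim : ∀ {x j} → Realises x j → ∀ σ → Selected σ → R (ext (x fz) (param j ∘ σ))
  realises-elim {x} {j} sat σ sel =
    resp-≗ R-uniform (guarded-elim {d = selected? σ} (⋀ⁿ-elim k1 {G = atom} atom-cong sat σ) sel)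
                     (ext-∘ ρ {inj₁ fz} {inj₂ ∘ σ})
    where
    ρ = [ x , param j ]′

    atom-cong : ∀ {σ σ'} → σ ≗ σ' → Sat Vertex R (atom σ) ρ → Sat Vertex R (atom σ') ρ
    atom-cong {σ} {σ'} σ≗σ' sat = guarded-intro {d = selected? σ'} λ sel' →
      resp-≗ R-uniform
        (guarded-elim {d = selected? σ} sat λ i i' →
          subst₂ _<F_ (cong layerOf (sym (σ≗σ' i))) (cong layerOf (sym (σ≗σ' i'))) ∘ sel' i i')
        (cong ρ ∘ ext-cong (cong inj₂ ∘ σ≗σ'))

  module RealisedClique {s} {x : Fin 1 → Vertex} (realised : All (Realises x) s)
    {v : Fin n1 → ℕ} (v-inc : IncN v)
    (v-sub : ∀ g → IncF g → (λ i → v (g i)) ∈S s) (v-S : ∀ f → IncF f → S (λ i → v (f i))) where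

    vertexAt : Fin n1' → Point
    vertexAt ℓ = ℓ , ifLow ℓ (λ low → v (fromℕ< low)) 0

    base-clique : IsClique K R n1' (embed ∘ vertexAt)
    base-clique = (λ i j → cong layer ∘ embed-injective) , λ f f-inc →
      Equivalence.from R-embed (incF⇒injective f-inc , ordered f , low⇒S f f-inc)
      where
      ordered : ∀ (f : Fin K → Fin n1') r r' → Ordered (vertexAt (f r)) (vertexAt (f r'))
      ordered f r r' fr<fr' low' =
        subst₂ _<_ (sym (ifLow-low (<-trans fr<fr' low'))) (sym (ifLow-low low'))
          (v-inc _ _ (subst₂ _<_ (sym (toℕ-fromℕ< _)) (sym (toℕ-fromℕ< _)) fr<fr'))

      low⇒S : ∀ f → IncF f → (∀ r → Low (f r)) → S (index ∘ vertexAt ∘ f)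
      low⇒S f f-inc all-low =
        resp-≗ (proj₁ S-random) (v-S (λ r → fromℕ< (all-low r)) lowered-inc) (sym ∘ ifLow-low ∘ all-low)
        where
        lowered-inc : IncF (λ r → fromℕ< (all-low r))
        lowered-inc i j i<j = subst₂ _<_ (sym (toℕ-fromℕ< _)) (sym (toℕ-fromℕ< _)) (f-inc i j i<j)

    x-adjacent : ∀ t → IncF t → R (ext (x fz) (embed ∘ vertexAt ∘ t))
    x-adjacent t t-inc =
      resp-≗ R-uniform (realises-elim {j = j} realises-j σ σ-selected) (ext-cong (cong embed ∘ σ-point))
      where
      squeezed = squeeze k1≤n1 (toℕ ∘ t) t-inc
      g = proj₁ squeezed
      cover = proj₂ (proj₂ squeezed)

      j-in-s = v-sub g (proj₁ (proj₂ squeezed))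
      j = Any.lookup j-in-s
      realises-j = proj₁ (lookupAny realised j-in-s)
      j≗v∘g = proj₂ (lookupAny realised j-in-s)

      position : Fin k1 → Fin k1
      position r = ifLow (t r) (λ low → proj₁ (cover r low)) fz

      σ : Fin k1 → Fin q
      σ r = combine (t r) (position r)

      remQuot-σ : ∀ r → remQuot {n1'} k1 (σ r) ≡ (t r , position r)
      remQuot-σ r = remQuot-combine {n1'} (t r) (position r)

      σ-selected : Selected σ
      σ-selected i i' i<i' =
        subst₂ _<F_ (sym (cong proj₁ (remQuot-σ i))) (sym (cong proj₁ (remQuot-σ i'))) (t-inc i i' i<i')

      σ-point : ∀ r → pointOf j (remQuot {n1'} k1 (σ r)) ≡ vertexAt (t r)
      σ-point r = trans (cong (pointOf j) (remQuot-σ r)) (cong (t r ,_) (ifLow-cong λ low → begin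
        proj₁ j (position r)            ≡⟨ cong (proj₁ j) (ifLow-low low) ⟩
        proj₁ j (proj₁ (cover r low))   ≡⟨ j≗v∘g _ ⟩
        v (g (proj₁ (cover r low)))     ≡⟨ cong v (toℕ-injective (trans (proj₂ (cover r low))
                                                                        (sym (toℕ-fromℕ< low)))) ⟩
        v (fromℕ< low)                  ∎))
        where open ≡-Reasoning

    x-fresh : ∀ ℓ → x fz ≢ embed (vertexAt ℓ)
    x-fresh ℓ e with incF-through ℓ (s≤s z≤n) (≤-trans k1≤n1 n1≤n1')
    ... | t , t-inc , p , ℓ≡tp =
      fz≢fs (proj₁ R-uniform (ext (x fz) (embed ∘ vertexAt ∘ t)) (x-adjacent t t-inc) fz (fs p)
                             (trans e (cong (embed ∘ vertexAt) ℓ≡tp)))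
      where
      fz≢fs : fz ≢ fs p
      fz≢fs ()

    clique : IsClique K R n' (ext (x fz) (embed ∘ vertexAt))
    clique = cone R-uniform base-clique x-fresh x-adjacent

  realised⇒Δ : ∀ {s} (x : Fin 1 → Vertex) → All (Realises x) s → Δ[ suc n1 , K ] S s
  realised⇒Δ x realised (v , v-inc , v-sub , v-S) =
    cliqueFree _ (RealisedClique.clique realised v-inc v-sub v-S)

  bound : List (Subsets k1) → ℕ
  bound [] = 0
  bound (j ∷ s) = ⨆ (proj₁ j) ⊔ bound s

  ≤-bound : ∀ {j s} → j ∈ s → ∀ p → proj₁ j p ≤ bound s
  ≤-bound {j} (here refl) p = ≤-trans (≤-⨆ (proj₁ j) p) (m≤m⊔n _ _)
  ≤-bound (there j∈s) p = ≤-trans (≤-bound j∈s p) (m≤n⊔m _ _)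

  module RealisationOfΔ {s : List (Subsets k1)} (no-clique : Δ[ suc n1 , K ] S s) where

    N M : ℕ
    N = suc (bound s)
    M = n1' * N

    enum : Fin M → Point
    enum y = proj₁ (remQuot {n1'} N y) , toℕ (proj₂ (remQuot {n1'} N y))

    enum-injective : Injective enum
    enum-injective y y' e = trans (sym (combine-remQuot {n1'} N y))
      (trans (cong₂ combine (cong proj₁ e) (toℕ-injective (cong proj₂ e))) (combine-remQuot {n1'} N y'))

    encode : (x : Point) → index x < N → Fin M
    encode x i<N = combine (layer x) (fromℕ< i<N)

    enum-encode : ∀ x (i<N : index x < N) → enum (encode x i<N) ≡ x
    enum-encode x i<N = cong₂ _,_ (cong proj₁ rq) (trans (cong (toℕ ∘ proj₂) rq) (toℕ-fromℕ< i<N))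
      where
      rq = remQuot-combine {n1'} (layer x) (fromℕ< i<N)

    Covered : Subsets k1 → (Fin k1 → Fin M) → Set
    Covered j t = ∀ r → Low (layer (enum (t r))) → ∃ λ p → proj₁ j p ≡ index (enum (t r))

    covered? : ∀ j t → Dec (Covered j t)
    covered? j t =
      all? λ r → (toℕ (layer (enum (t r))) <? n1) →-dec any? λ p → proj₁ j p ≟ index (enum (t r))

    P : (Fin k1 → Fin M) → Bool
    P t = does (Any.any? (λ j → covered? j t) s)

    P-sound : ∀ t → P t ≡ true → Any (λ j → Covered j t) s
    P-sound t with Any.any? (λ j → covered? j t) s
    ... | yes covered = λ _ → covered
    ... | no _ = λ ()

    module InducedClique {w : Fin n1' → Fin M} (w-inc : IncF w)
      (selected : ∀ g → IncF g → P (λ i → w (g i)) ≡ true)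
      (edges : ∀ f → IncF f → R (λ i → embed (enum (w (f i))))) where

      u : Fin n1' → Point
      u = enum ∘ w

      u-edges : ∀ f → IncF f → LayeredEdge (u ∘ f)
      u-edges f f-inc = Equivalence.to R-embed (edges f f-inc)

      layer≡ : ∀ r → layer (u r) ≡ r
      layer≡ = incF-endo-≗id (layer ∘ u) λ r r' r<r' →
        Finₚ.≤∧≢⇒< (remQuot-mono N (w-inc r r' r<r'))
                   (proj₁ (layered-pair 2≤K K≤n1' u u-edges (Finₚ.<⇒≢ r<r')))

      ι : Fin n1 → Fin n1'
      ι ℓ = inject≤ ℓ n1≤n1'

      ι-inc : IncF ι
      ι-inc ℓ ℓ' = subst₂ _<_ (sym (toℕ-inject≤ ℓ n1≤n1')) (sym (toℕ-inject≤ ℓ' n1≤n1'))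

      low : ∀ ℓ → Low (layer (u (ι ℓ)))
      low ℓ = subst (λ r → toℕ r < n1) (sym (layer≡ (ι ℓ)))
                    (subst (_< n1) (sym (toℕ-inject≤ ℓ n1≤n1')) (toℕ<n ℓ))

      v : Fin n1 → ℕ
      v = index ∘ u ∘ ι

      v-inc : IncN v
      v-inc ℓ ℓ' ℓ<ℓ' = proj₂ (layered-pair 2≤K K≤n1' u u-edges (Finₚ.<⇒≢ (ι-inc ℓ ℓ' ℓ<ℓ')))
        (subst₂ _<F_ (sym (layer≡ (ι ℓ))) (sym (layer≡ (ι ℓ'))) (ι-inc ℓ ℓ' ℓ<ℓ')) (low ℓ')

      v-S : ∀ f → IncF f → S (v ∘ f)
      v-S f f-inc = proj₂ (proj₂ (u-edges (ι ∘ f) (λ i j → ι-inc _ _ ∘ f-inc i j))) (low ∘ f)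

      v-sub : ∀ g → IncF g → (v ∘ g) ∈S s
      v-sub g g-inc =
        Any.map (λ {j} covered → sym ∘ v∘g≗j {j} covered)
                (P-sound (w ∘ ι ∘ g) (selected (ι ∘ g) (λ i j → ι-inc _ _ ∘ g-inc i j)))
        where
        v∘g≗j : ∀ {j} → Covered j (w ∘ ι ∘ g) → v ∘ g ≗ proj₁ j
        v∘g≗j {j} covered = incN-⊆ᵢ⇒≗ (λ i i' → v-inc _ _ ∘ g-inc i i') (proj₂ j) λ r →
          proj₁ (covered r (low (g r))) , sym (proj₂ (covered r (low (g r))))

    allowed : NoNewClique K R n' M (embed ∘ enum) P
    allowed w w-inc selected edges = no-clique (v , v-inc , v-sub , v-S)
      where open InducedClique w-inc selected edges

    extended = extension M (embed ∘ enum) (λ i j → enum-injective i j ∘ embed-injective) P allowed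

    newVertex : Vertex
    newVertex = proj₁ extended

    module _ {j} (j∈s : j ∈ s) (σ : Fin k1 → Fin q) (σ-selected : Selected σ) where

      point : Fin k1 → Point
      point r = pointOf j (remQuot {n1'} k1 (σ r))

      point<N : ∀ r → index (point r) < N
      point<N r = s≤s (ifLow-≤ (λ _ → ≤-bound j∈s _) z≤n)

      t : Fin k1 → Fin M
      t r = encode (point r) (point<N r)

      t-inc : IncF t
      t-inc i i' i<i' = combine-monoˡ-< _ _ (σ-selected i i' i<i')

      enum∘t≡point : ∀ r → enum (t r) ≡ point r
      enum∘t≡point r = enum-encode (point r) (point<N r)

      covered : Covered j t
      covered r low = proj₂ (remQuot {n1'} k1 (σ r)) ,
        sym (trans (cong index (enum∘t≡point r))
                   (ifLow-low (subst (Low ∘ layer) (enum∘t≡point r) low)))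

      newVertex-adjacent : R (ext newVertex (param j ∘ σ))
      newVertex-adjacent = resp-≗ R-uniform
        (Equivalence.from (proj₂ (proj₂ extended) t t-inc)
           (dec-true (Any.any? (λ j' → covered? j' t) s) (Any.map (λ { refl → covered }) j∈s)))
        (ext-cong (cong embed ∘ enum∘t≡point))

    realises : All (Realises (λ _ → newVertex)) s
    realises = All.tabulate λ {j} j∈s → realises-intro {j = j} (newVertex-adjacent j∈s)

  Δ⇒realised : ∀ {s} → Δ[ suc n1 , K ] S s → ∃ λ x → All (Realises x) s
  Δ⇒realised no-clique = _ , RealisationOfΔ.realises no-clique

theorem7p7 : ∀ (k n n' : ℕ) → 2 ≤ k → k < n → n ≤ n' →
    (S : (Fin k → ℕ) → Set) → IsRandomHypergraphOnℕ k S →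
    AdmitsT n' k (Subsets (pred k)) (Δ[ n , k ] S)
theorem7p7 (suc (suc k2)) (suc n1) (suc n1') (s≤s (s≤s z≤n)) (s≤s K≤n1) (s≤s n1≤n1') S S-random =
  1 , q , φ , Vertex , R , isModel , param , λ s → mk⇔ (uncurry realised⇒Δ) Δ⇒realised
  where
  open Pattern k2 n1 n1' K≤n1 n1≤n1' S S-random
  open Model using (Vertex; R; isModel)
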